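{- Let $G$ be a finite simple graph, let $S\subseteq V(G)$, let $v,v'\in V(G)$, and let $S'=S\cup\{v'\}$. If $t(S',v)<t(S,v)$, then there is an $S'$-infection path starting in $v'$ and ending in $v$.
   Context: 2-neighbor bootstrap percolation on a graph $G$: given $S\subseteq V(G)$, set $S_0=S$ and let $S_{i+1}$ be $S_i$ together with all vertices of $G$ having at least two neighbors in $S_i$. For a vertex $u$, $t(S,u)$ denotes the minimum $t$ with $u\in S_t$, and $t(S,u)=\infty$ if no such $t$ exists. For a set $Q\subseteq V(G)$, a path $P=u_0,u_1,\dots,u_m$ in $G$ is a $Q$-infection path if $t(Q,u_i)<t(Q,u_{i+1})$ for every $0\le i\le m-1$. -}

module Defs where

open import Data.Nat using (ℕ; zero; suc; _+_; _<_; _≤_)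
open import Data.Bool using (Bool; true; false; _∧_; _∨_; if_then_else_)
open import Data.Fin using (Fin; zero; suc; fromℕ; inject₁; _≟_)
open import Data.List using (List; map; allFin)
open import Data.Nat.ListAction using (sum)
open import Data.Product using (Σ; _×_; ∃; ∃-syntax)
open import Relation.Binary.PropositionalEquality using (_≡_)
open import Relation.Nullary using (¬_; does)
open import Function.Definitions using (Injective)

record Graph (n : ℕ) : Set where
  field
    adj   : Fin n → Fin n → Bool
    sym   : ∀ u w → adj u w ≡ adj w u
    irref : ∀ u → adj u u ≡ false
open Graph public

VSet : ℕ → Set
VSet n = Fin n → Bool

insert : ∀ {n} → Fin n → VSet n → VSet n
insert v' S u = does (u ≟ v') ∨ S u

nbrCount : ∀ {n} → Graph n → VSet n → Fin n → ℕ
nbrCount G S u = sum (map (λ w → if adj G u w ∧ S w then 1 else 0) (allFin _))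

two≤ : ℕ → Bool
two≤ (suc (suc _)) = true
two≤ _ = false

-- one round of 2-neighbour bootstrap percolation
step : ∀ {n} → Graph n → VSet n → VSet n
step G S u = S u ∨ two≤ (nbrCount G S u)

infected : ∀ {n} → Graph n → VSet n → ℕ → VSet n
infected G S zero = S
infected G S (suc i) = step G (infected G S i)

data ℕ∞ : Set where
  fin : ℕ → ℕ∞
  ∞   : ℕ∞

data _<∞_ : ℕ∞ → ℕ∞ → Set where
  fin<fin : ∀ {a b} → a < b → fin a <∞ fin b
  fin<∞   : ∀ {a} → fin a <∞ ∞

-- InfTime G S u t  :⇔  t(S,u) = t  (minimum t with u ∈ S_t, or ∞ if none)
data InfTime {n} (G : Graph n) (S : VSet n) (u : Fin n) : ℕ∞ → Set where
  at    : ∀ k → infected G S k u ≡ true → (∀ j → j < k → infected G S j u ≡ false)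
        → InfTime G S u (fin k)
  never : (∀ k → infected G S k u ≡ false) → InfTime G S u ∞

TimeLt : ∀ {n} → Graph n → VSet n → Fin n → VSet n → Fin n → Set
TimeLt G S u T w = ∃[ a ] ∃[ b ] (InfTime G S u a × InfTime G T w b × a <∞ b)

IsPath : ∀ {n} → Graph n → (m : ℕ) → (Fin (suc m) → Fin n) → Set
IsPath G m p = Injective _≡_ _≡_ p × (∀ (i : Fin m) → adj G (p (inject₁ i)) (p (suc i)) ≡ true)

InfectionPath : ∀ {n} → Graph n → VSet n → Fin n → Fin n → Set
InfectionPath {n} G Q a b =
  ∃[ m ] Σ (Fin (suc m) → Fin n) λ p →
    IsPath G m p × p zero ≡ a × p (fromℕ m) ≡ b
    × (∀ (i : Fin m) → TimeLt G Q (p (inject₁ i)) Q (p (suc i)))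

-- Induction on k = t(S′,v). If v ≠ v′ then k = j + 1 and v has two neighbours in
-- S′_j but fewer than two in S_j, so some neighbour w lies in S′_j ∖ S_j. Its
-- time a = t(S′,w) ≤ j satisfies a < t(S,w), so by induction there is an
-- S′-infection path from v′ to w, all of whose vertices are infected by time a;
-- hence v is not on it, and appending v gives the required path.
module Submission where

open import Defs hiding (sym)
open import Data.Bool using (true; false; _∧_; _∨_; if_then_else_)
open import Data.Bool.Properties using (∨-conicalʳ)
open import Data.Empty using (⊥-elim)
open import Data.Fin using (Fin; zero; suc; fromℕ; inject₁; _≟_)
open import Data.List using (List; []; _∷_; map; allFin)
open import Data.Nat using (ℕ; zero; suc; _≤_; _<_; _≤′_; ≤′-refl; ≤′-step; _≤?_; z≤n; s≤s)
open import Data.Nat.Induction using (<-rec)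
open import Data.Nat.ListAction using (sum)
open import Data.Nat.Properties
  using (≤-refl; ≤-pred; <⇒≤; m≤n⇒m≤1+n; +-mono-≤; ≰⇒>; ≤⇒≤′)
open import Data.Product using (Σ; _×_; ∃; ∃-syntax; _,_)
open import Data.Sum using (_⊎_; inj₁; inj₂)
open import Function using (_∘_)
open import Function.Definitions using (Injective)
open import Relation.Binary.PropositionalEquality using (_≡_; _≢_; refl; sym; trans; cong; subst; subst₂)
open import Relation.Nullary using (yes; no)
open import Relation.Nullary.Decidable using (dec-false)

sum-map-≤-or-witness : ∀ {a} {A : Set a} (f g : A → ℕ) (xs : List A) →
                       sum (map f xs) ≤ sum (map g xs) ⊎ ∃ λ x → g x < f x
sum-map-≤-or-witness f g [] = inj₁ z≤n
sum-map-≤-or-witness f g (x ∷ xs) with sum-map-≤-or-witness f g xs | f x ≤? g x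
... | inj₂ witness | _        = inj₂ witness
... | inj₁ rest    | yes fx≤gx = inj₁ (+-mono-≤ fx≤gx rest)
... | inj₁ _       | no fx≰gx  = inj₂ (x , ≰⇒> fx≰gx)

two≤-mono : ∀ {a b} → a ≤ b → two≤ a ≡ true → two≤ b ≡ true
two≤-mono (s≤s (s≤s _)) refl = refl

true≢false : ∀ {b} → b ≡ true → b ≢ false
true≢false refl ()

∨-trueʳ : ∀ {a b} → a ≡ false → a ∨ b ≡ true → b ≡ true
∨-trueʳ refl a∨b = a∨b

module _ {a} {A : Set a} where

  Chain : ∀ {ℓ} → (A → A → Set ℓ) → ∀ {m} → (Fin (suc m) → A) → Set ℓ
  Chain R {m} p = ∀ (i : Fin m) → R (p (inject₁ i)) (p (suc i))

  snoc : ∀ {m} → (Fin m → A) → A → Fin (suc m) → A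
  snoc {zero}  p x zero    = x
  snoc {suc m} p x zero    = p zero
  snoc {suc m} p x (suc i) = snoc (p ∘ suc) x i

  snoc-inject₁ : ∀ {m} (p : Fin m → A) x (i : Fin m) → snoc p x (inject₁ i) ≡ p i
  snoc-inject₁ {suc m} p x zero    = refl
  snoc-inject₁ {suc m} p x (suc i) = snoc-inject₁ (p ∘ suc) x i

  snoc-last : ∀ {m} (p : Fin m → A) x → snoc p x (fromℕ m) ≡ x
  snoc-last {zero}  p x = refl
  snoc-last {suc m} p x = snoc-last (p ∘ suc) x

data Inject₁OrLast : ∀ {m} → Fin (suc m) → Set where
  inject : ∀ {m} (i : Fin m) → Inject₁OrLast (inject₁ i)
  last   : ∀ {m} → Inject₁OrLast (fromℕ m)

inject₁OrLast : ∀ {m} (i : Fin (suc m)) → Inject₁OrLast i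
inject₁OrLast {zero}  zero    = last
inject₁OrLast {suc m} zero    = inject zero
inject₁OrLast {suc m} (suc i) with inject₁OrLast i
... | inject j = inject (suc j)
... | last     = last

module _ {a} {A : Set a} where

  snoc-all : ∀ {ℓ m} {P : A → Set ℓ} {p : Fin m → A} {x} →
             (∀ i → P (p i)) → P x → ∀ i → P (snoc p x i)
  snoc-all {P = P} {p} {x} all-p px i with inject₁OrLast i
  ... | inject j = subst P (sym (snoc-inject₁ p x j)) (all-p j)
  ... | last     = subst P (sym (snoc-last p x)) px

  snoc-injective : ∀ {m} {p : Fin m → A} {x} →
                   Injective _≡_ _≡_ p → (∀ i → p i ≢ x) → Injective _≡_ _≡_ (snoc p x)
  snoc-injective {p = p} {x} p-inj x∉p {i} {j} eq with inject₁OrLast i | inject₁OrLast j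
  ... | inject i′ | inject j′ = cong inject₁ (p-inj (trans (sym (snoc-inject₁ p x i′)) (trans eq (snoc-inject₁ p x j′))))
  ... | inject i′ | last      = ⊥-elim (x∉p i′ (trans (sym (snoc-inject₁ p x i′)) (trans eq (snoc-last p x))))
  ... | last      | inject j′ = ⊥-elim (x∉p j′ (trans (sym (snoc-inject₁ p x j′)) (trans (sym eq) (snoc-last p x))))
  ... | last      | last      = refl

  snoc-chain : ∀ {ℓ m} {R : A → A → Set ℓ} {p : Fin (suc m) → A} {x} →
               Chain R p → R (p (fromℕ m)) x → Chain R (snoc p x)
  snoc-chain {R = R} {p} {x} chain-p last-x i with inject₁OrLast i
  ... | inject j = subst₂ R (sym (snoc-inject₁ p x (inject₁ j))) (sym (snoc-inject₁ p x (suc j))) (chain-p j)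
  ... | last {m} = subst₂ R (sym (snoc-inject₁ p x (fromℕ m))) (sym (snoc-last p x)) last-x

insert-other : ∀ {n} (S : VSet n) {u v′} → u ≢ v′ → insert v′ S u ≡ S u
insert-other S {u} {v′} u≢v′ = cong (_∨ S u) (dec-false (u ≟ v′) u≢v′)

module _ {n} (G : Graph n) where

  Adjacent : Fin n → Fin n → Set
  Adjacent u w = adj G u w ≡ true

  infected-mono : ∀ {T : VSet n} {u i k} → i ≤ k → infected G T i u ≡ true → infected G T k u ≡ true
  infected-mono i≤k = go (≤⇒≤′ i≤k)
    where
    go : ∀ {T : VSet n} {u i k} → i ≤′ k → infected G T i u ≡ true → infected G T k u ≡ true
    go ≤′-refl          e = e
    go (≤′-step i≤k) e rewrite go i≤k e = refl

  uninfected-antitone : ∀ {T : VSet n} {u i k} → i ≤ k → infected G T k u ≡ false → infected G T i u ≡ false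
  uninfected-antitone {T} {u} {i} i≤k uk with infected G T i u in ui
  ... | false = refl
  ... | true  = ⊥-elim (true≢false (infected-mono i≤k ui) uk)

  firstInfection : ∀ {T : VSet n} {u} j → infected G T j u ≡ true → ∃ λ a → a ≤ j × InfTime G T u (fin a)
  firstInfection zero uj = zero , z≤n , at zero uj (λ _ ())
  firstInfection {T} {u} (suc j) uj = byPreviousRound (infected G T j u) refl
    where
    byPreviousRound : ∀ b → infected G T j u ≡ b → ∃ λ a → a ≤ suc j × InfTime G T u (fin a)
    byPreviousRound true  uj′ = let a , a≤j , ta = firstInfection j uj′ in a , m≤n⇒m≤1+n a≤j , ta
    byPreviousRound false uj′ =
      suc j , ≤-refl , at (suc j) uj (λ i i<1+j → uninfected-antitone (≤-pred i<1+j) uj′)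

  uninfected-before : ∀ {T : VSet n} {u k b} → InfTime G T u b → fin k <∞ b → infected G T k u ≡ false
  uninfected-before (at _ _ earlier) (fin<fin k<b) = earlier _ k<b
  uninfected-before {k = k} (never none) fin<∞ = none k

  nbrIndicator : VSet n → Fin n → Fin n → ℕ
  nbrIndicator T u w = if adj G u w ∧ T w then 1 else 0

  nbrIndicator-< : ∀ (A B : VSet n) u w → nbrIndicator B u w < nbrIndicator A u w →
                   Adjacent u w × A w ≡ true × B w ≡ false
  nbrIndicator-< A B u w lt with adj G u w | A w | B w | lt
  ... | true  | true  | false | _        = refl , refl , refl
  ... | true  | true  | true  | s≤s ()
  ... | true  | false | _     | ()
  ... | false | _     | _     | ()

  neighbourIn-∖ : ∀ (A B : VSet n) u → two≤ (nbrCount G A u) ≡ true → two≤ (nbrCount G B u) ≡ false →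
                  ∃ λ w → Adjacent u w × A w ≡ true × B w ≡ false
  neighbourIn-∖ A B u twoA twoB with sum-map-≤-or-witness (nbrIndicator A u) (nbrIndicator B u) (allFin n)
  ... | inj₁ A≤B      = ⊥-elim (true≢false (two≤-mono A≤B twoA) twoB)
  ... | inj₂ (w , lt) = w , nbrIndicator-< A B u w lt

  newlyInfectedNeighbour : ∀ (Q S : VSet n) u j →
                           infected G Q (suc j) u ≡ true → infected G Q j u ≡ false →
                           infected G S (suc j) u ≡ false →
                           ∃ λ w → Adjacent u w × infected G Q j w ≡ true × infected G S j w ≡ false
  newlyInfectedNeighbour Q S u j Qu Qu-before Su =
    neighbourIn-∖ (infected G Q j) (infected G S j) u
      (∨-trueʳ Qu-before Qu)
      (∨-conicalʳ _ _ Su)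

  module _ (Q : VSet n) where

    InfectionPathBy : Fin n → Fin n → ℕ → Set
    InfectionPathBy a b k = ∃[ m ] Σ (Fin (suc m) → Fin n) λ p →
      IsPath G m p × p zero ≡ a × p (fromℕ m) ≡ b
      × Chain (λ x y → TimeLt G Q x Q y) p
      × (∀ i → infected G Q k (p i) ≡ true)

    trivialInfectionPathBy : ∀ {a k} → infected G Q k a ≡ true → InfectionPathBy a a k
    trivialInfectionPathBy {a} Qa =
      zero , (λ _ → a) , (single-injective , λ ()) , refl , refl , (λ ()) , λ _ → Qa
      where
      single-injective : Injective _≡_ _≡_ (λ (_ : Fin 1) → a)
      single-injective {zero} {zero} _ = refl

    extendInfectionPathBy : ∀ {a w v i k} → InfectionPathBy a w i → InfTime G Q w (fin i) →
                            InfTime G Q v (fin k) → i < k → Adjacent w v → InfectionPathBy a v k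
    extendInfectionPathBy {v = v} {k = k} (m , p , (p-inj , p-adj) , p₀ , pₘ , p-time , p-by)
                          tw tv@(at _ Qv v-before) i<k wv =
      suc m , snoc p v
      , (snoc-injective p-inj v∉p , snoc-chain {R = Adjacent} p-adj (subst (λ x → Adjacent x v) (sym pₘ) wv))
      , p₀ , snoc-last p v
      , snoc-chain {R = λ x y → TimeLt G Q x Q y} p-time (subst (λ x → TimeLt G Q x Q v) (sym pₘ) (_ , _ , tw , tv , fin<fin i<k))
      , snoc-all {P = λ x → infected G Q k x ≡ true} (λ j → infected-mono (<⇒≤ i<k) (p-by j)) Qv
      where
      v∉p : ∀ j → p j ≢ v
      v∉p j refl = true≢false (p-by j) (v-before _ i<k)

module _ {n} (G : Graph n) (S : VSet n) (v′ : Fin n) where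

  private
    S′ = insert v′ S

  PathFromSeedAt : ℕ → Set
  PathFromSeedAt k = ∀ v → InfTime G S′ v (fin k) → infected G S k v ≡ false → InfectionPathBy G S′ v′ v k

  infectionPathFromSeed : ∀ k → PathFromSeedAt k
  infectionPathFromSeed = <-rec PathFromSeedAt go
    where
    go : ∀ k → (∀ {a} → a < k → PathFromSeedAt a) → PathFromSeedAt k
    go k rec v (at _ S′v _) Sv with v ≟ v′
    ... | yes refl = trivialInfectionPathBy G S′ {k = k} S′v
    go zero rec v (at _ S′v _) Sv | no v≢v′ =
      ⊥-elim (true≢false (trans (sym (insert-other S v≢v′)) S′v) Sv)
    go (suc j) rec v tv@(at _ S′v v-before) Sv | no _ =
      let w , vw , S′w , Sw = newlyInfectedNeighbour G S′ S v j S′v (v-before j ≤-refl) Sv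
          a , a≤j , tw = firstInfection G j S′w
      in extendInfectionPathBy G S′
           (rec (s≤s a≤j) w tw (uninfected-antitone G a≤j Sw)) tw tv (s≤s a≤j)
           (trans (Graph.sym G w v) vw)

lemma1 : ∀ {n} (G : Graph n) (S : VSet n) (v v' : Fin n)
         → TimeLt G (insert v' S) v S v
         → InfectionPath G (insert v' S) v' v
lemma1 G S v v' (fin k , _ , tv , tSv , k<t) =
  let m , p , path , p₀ , pₘ , p-time , _ =
        infectionPathFromSeed G S v' k v tv (uninfected-before G tSv k<t)
  in m , p , path , p₀ , pₘ , p-time
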